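{- In the setting below, let $k\in\{5,\dots,c\}$ and assume $H_k\ne\emptyset$. Then for every machine $i\in H_k$ and every machine $i''\in M\setminus H_{k-4}$ we have $s_i\ge 2\,s_{i''}$.
   Context: Setting: machines $M=\{1,\dots,m\}$ with speeds $s_1\ge s_2\ge\dots\ge s_m>0$ (unrestricted related machines), jobs with processing requirements $p_j\in[0,1]$; job $j$ on machine $i$ takes time $p_j/s_i$. For a schedule, $J_i$ is the set of jobs on machine $i$ and $L_i=\sum_{j\in J_i}p_j/s_i$ its load. $C^*>0$ is the optimal makespan. Fix a schedule $\sigma$ with makespan $C_{\max}(\sigma)$ that is a near list schedule: the jobs are indexed $1,\dots,n$ such that, with $J_{i,j}=J_i\cap\{1,\dots,j\}$, for all machines $i'\ne i$ and all $j\in J_i$: $L_{i'}+p_j/s_{i'}\ge L_i-\sum_{\ell\in J_{i,j-1}}p_\ell/s_i$ (all of $J_i,L_i,J_{i,j}$ refer to $\sigma$). Let $c=\lfloor C_{\max}(\sigma)/C^*\rfloor-1$. For each integer $k$ let $H_k=\{i\in M: L_{i'}\ge kC^*\text{ for all }i'\le i\}$ (an initial segment of $M$; $H_k=M$ for $k\le0$).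
   Formalization: The speeds $s_i$, the processing requirements $p_j$ and the optimal makespan $C^*$ are rational numbers. -}

module Defs where

open import Data.Nat as ℕ using (ℕ; zero; suc)
open import Data.Fin as Fin using (Fin; zero; suc; _≟_)
open import Data.Integer as ℤ using (ℤ)
open import Data.Rational as ℚ using (ℚ; 0ℚ; _+_; _-_; _*_; _÷_; _⊔_; _≤_; _<_; >-nonZero)
open import Data.Product using (Σ; _×_; ∃-syntax)
open import Relation.Binary.PropositionalEquality using (_≡_)
open import Relation.Nullary using (¬_; does)
open import Data.Bool using (if_then_else_)

divPos : (p q : ℚ) → 0ℚ < q → ℚ
divPos p q q>0 = _÷_ p q {{>-nonZero q>0}}

sumFin : (n : ℕ) → (Fin n → ℚ) → ℚ
sumFin zero    f = 0ℚ
sumFin (suc n) f = f zero + sumFin n (λ x → f (suc x))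

-- max_{x ∈ Fin n} f x  (0 for the empty index set)
maxFin : (n : ℕ) → (Fin n → ℚ) → ℚ
maxFin zero    f = 0ℚ
maxFin (suc n) f = f zero ⊔ maxFin n (λ x → f (suc x))

-- A schedule assigns each job (Fin n) to a machine (Fin m); J_i = {j | σ j ≡ i}.
Schedule : ℕ → ℕ → Set
Schedule n m = Fin n → Fin m

workOn : {n m : ℕ} → (p : Fin n → ℚ) → Schedule n m → Fin m → ℚ
workOn {n} p σ i = sumFin n (λ j → if does (σ j ≟ i) then p j else 0ℚ)

-- Σ_{ℓ ∈ J_{i,j-1}} p_ℓ  = sum of p_ℓ over jobs ℓ on machine i with ℓ < j
workOnBefore : {n m : ℕ} → (p : Fin n → ℚ) → Schedule n m → Fin m → Fin n → ℚ
workOnBefore {n} p σ i j =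
  sumFin n (λ ℓ → if does (σ ℓ ≟ i) then (if does (Fin._<?_ ℓ j) then p ℓ else 0ℚ) else 0ℚ)

load : {n m : ℕ} (p : Fin n → ℚ) (s : Fin m → ℚ) → (∀ i → 0ℚ < s i) →
       Schedule n m → Fin m → ℚ
load p s spos σ i = divPos (workOn p σ i) (s i) (spos i)

makespan : {n m : ℕ} (p : Fin n → ℚ) (s : Fin m → ℚ) → (∀ i → 0ℚ < s i) →
           Schedule n m → ℚ
makespan {m = m} p s spos σ = maxFin m (load p s spos σ)

IsOptimalMakespan : {n m : ℕ} (p : Fin n → ℚ) (s : Fin m → ℚ) → (∀ i → 0ℚ < s i) →
                    ℚ → Set
IsOptimalMakespan {n} {m} p s spos C =
  (Σ (Schedule n m) λ σ* → makespan p s spos σ* ≡ C) ×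
  ((τ : Schedule n m) → C ≤ makespan p s spos τ)

IsNearListSchedule : {n m : ℕ} (p : Fin n → ℚ) (s : Fin m → ℚ) → (spos : ∀ i → 0ℚ < s i) →
                     Schedule n m → Set
IsNearListSchedule {n} {m} p s spos σ =
  (i i' : Fin m) (j : Fin n) → ¬ (i' ≡ i) → σ j ≡ i →
    load p s spos σ i - divPos (workOnBefore p σ i j) (s i) (spos i)
      ≤ load p s spos σ i' + divPos (p j) (s i') (spos i')

InH : {n m : ℕ} (p : Fin n → ℚ) (s : Fin m → ℚ) → (spos : ∀ i → 0ℚ < s i) →
      Schedule n m → (Cstar : ℚ) → ℕ → Fin m → Set
InH p s spos σ Cstar k i =
  (i' : _) → i' Fin.≤ i → (ℤ.+ k ℚ./ 1) * Cstar ≤ load p s spos σ i'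

cValue : {n m : ℕ} (p : Fin n → ℚ) (s : Fin m → ℚ) → (spos : ∀ i → 0ℚ < s i) →
         Schedule n m → (Cstar : ℚ) → 0ℚ < Cstar → ℤ
cValue p s spos σ Cstar C>0 = ℚ.floor (divPos (makespan p s spos σ) Cstar C>0) ℤ.- ℤ.+ 1

-- Suppose s i < 2 s i''. Some machine i₀ ≤ i'' has load below (k-4)C*, and
-- s i₀ ≥ s i'' > s i / 2. On each machine h ≤ i (load at least kC*) the jobs
-- starting by time 2C* carry work at least 2C* s h. For such a job j the near
-- list property gives L h - start j ≤ L i₀ + p j / s i₀, hence p j > 2C* s i₀ > C* s i.
-- In an optimal schedule no machine h ≥ i has room for such a job (capacity C* s h ≤ C* s i),
-- so these jobs carry work at most Σ_{h<i} C* s h < Σ_{h≤i} 2C* s h: a contradiction.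
module Submission where

open import Defs
open import Data.Nat as ℕ using (ℕ; _∸_)
open import Data.Fin as Fin using (Fin)
open import Data.Integer as ℤ using ()
open import Data.Rational as ℚ using (ℚ; 0ℚ; 1ℚ; _≤_; _<_; _*_)
open import Data.Product using (Σ; _×_)
open import Relation.Nullary using (¬_)

open import Data.Bool using (if_then_else_)
open import Function using (_∘_)
open import Data.Empty using (⊥; ⊥-elim)
open import Data.Fin using (zero; suc; _≟_)
open import Data.Nat using (zero; suc)
open import Data.Product using (_,_; proj₁)
open import Data.Rational using (_+_; _-_; -_)
open import Data.Rational.Unnormalised as ℚᵘ using (mkℚᵘ; *≡*)
open import Relation.Binary.PropositionalEquality
open import Relation.Nullary using (Dec; yes; no; does)
open import Relation.Nullary.Decidable using (_→-dec_)
import Data.Fin.Properties as Finₚ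
import Data.Integer.Properties as ℤₚ
import Data.Integer.Solver as ℤSolver
import Data.Nat.Coprimality as Coprimality
import Data.Nat.Properties as ℕₚ
import Data.Rational.Properties as ℚₚ
import Data.Rational.Solver as ℚSolver
import Data.Rational.Unnormalised.Properties as ℚᵘₚ

two : ℚ
two = ℤ.+ 2 ℚ./ 1

toℚᵘ-+/1 : ∀ a → ℚ.toℚᵘ (ℤ.+ a ℚ./ 1) ≡ mkℚᵘ (ℤ.+ a) 0
toℚᵘ-+/1 a = cong ℚ.toℚᵘ (ℚₚ.normalize-coprime (Coprimality.sym (Coprimality.1-coprimeTo a)))

+/1-homo-+ : ∀ a b → ℤ.+ (a ℕ.+ b) ℚ./ 1 ≡ ℤ.+ a ℚ./ 1 + ℤ.+ b ℚ./ 1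
+/1-homo-+ a b = ℚₚ.toℚᵘ-injective (begin
  ℚ.toℚᵘ (ℤ.+ (a ℕ.+ b) ℚ./ 1)
    ≡⟨ toℚᵘ-+/1 (a ℕ.+ b) ⟩
  mkℚᵘ (ℤ.+ (a ℕ.+ b)) 0
    ≈⟨ *≡* (cong (ℤ._* ℤ.+ 1) (ℤₚ.pos-+ a b)) ⟩
  mkℚᵘ (ℤ.+ a ℤ.+ ℤ.+ b) 0
    ≈⟨ *≡* (numerators (ℤ.+ a) (ℤ.+ b)) ⟩
  mkℚᵘ (ℤ.+ a) 0 ℚᵘ.+ mkℚᵘ (ℤ.+ b) 0
    ≡⟨ cong₂ ℚᵘ._+_ (toℚᵘ-+/1 a) (toℚᵘ-+/1 b) ⟨
  ℚ.toℚᵘ (ℤ.+ a ℚ./ 1) ℚᵘ.+ ℚ.toℚᵘ (ℤ.+ b ℚ./ 1)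
    ≈⟨ ℚₚ.toℚᵘ-homo-+ (ℤ.+ a ℚ./ 1) (ℤ.+ b ℚ./ 1) ⟨
  ℚ.toℚᵘ (ℤ.+ a ℚ./ 1 + ℤ.+ b ℚ./ 1) ∎)
  where
  open ℚᵘₚ.≃-Reasoning
  open ℤSolver.+-*-Solver
  numerators : ∀ x y → (x ℤ.+ y) ℤ.* ℤ.+ 1 ≡ (x ℤ.* ℤ.+ 1 ℤ.+ y ℤ.* ℤ.+ 1) ℤ.* ℤ.+ 1
  numerators = solve 2 (λ x y → (x :+ y) :* con (ℤ.+ 1)
                               := (x :* con (ℤ.+ 1) :+ y :* con (ℤ.+ 1)) :* con (ℤ.+ 1)) refl

module _ where
  open ℚSolver.+-*-Solver

  p+q-p≡q : ∀ p q → p + q - p ≡ q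
  p+q-p≡q = solve 2 (λ p q → p :+ q :- p := q) refl

  p+[q-p]≡q : ∀ p q → p + (q - p) ≡ q
  p+[q-p]≡q = solve 2 (λ p q → p :+ (q :- p) := q) refl

  p+p≡two*p : ∀ p → p + p ≡ two * p
  p+p≡two*p = solve 1 (λ p → p :+ p := con two :* p) refl

+-cancelˡ-≤ : ∀ p {q r} → p + q ≤ p + r → q ≤ r
+-cancelˡ-≤ p {q} {r} h = subst₂ _≤_ (p+q-p≡q p q) (p+q-p≡q p r) (ℚₚ.+-monoˡ-≤ (- p) h)

+-cancelˡ-< : ∀ p {q r} → p + q < p + r → q < r
+-cancelˡ-< p {q} {r} h = subst₂ _<_ (p+q-p≡q p q) (p+q-p≡q p r) (ℚₚ.+-monoˡ-< (- p) h)

p≤q+r⇒p-q≤r : ∀ {p q r} → p ≤ q + r → p - q ≤ r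
p≤q+r⇒p-q≤r {p} {q} {r} h = subst (p - q ≤_) (p+q-p≡q q r) (ℚₚ.+-monoˡ-≤ (- q) h)

p-q≤r⇒p≤q+r : ∀ {p q r} → p - q ≤ r → p ≤ q + r
p-q≤r⇒p≤q+r {p} {q} {r} h = subst (_≤ q + r) (p+[q-p]≡q q p) (ℚₚ.+-monoʳ-≤ q h)

q+p≤r⇒p≤r-q : ∀ {p q r} → q + p ≤ r → p ≤ r - q
q+p≤r⇒p≤r-q {p} {q} {r} h = subst (_≤ r - q) (p+q-p≡q q p) (ℚₚ.+-monoˡ-≤ (- q) h)

p≤r-q⇒q+p≤r : ∀ {p q r} → p ≤ r - q → q + p ≤ r
p≤r-q⇒q+p≤r {p} {q} {r} h = subst (q + p ≤_) (p+[q-p]≡q q r) (ℚₚ.+-monoʳ-≤ q h)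

p≤p+q : ∀ p {q} → 0ℚ ≤ q → p ≤ p + q
p≤p+q p {q} h = subst (_≤ p + q) (ℚₚ.+-identityʳ p) (ℚₚ.+-monoʳ-≤ p h)

p≤two*p : ∀ {p} → 0ℚ ≤ p → p ≤ two * p
p≤two*p {p} h = subst (p ≤_) (p+p≡two*p p) (p≤p+q p h)

*-nonNeg : ∀ {p q} → 0ℚ ≤ p → 0ℚ ≤ q → 0ℚ ≤ p * q
*-nonNeg {p} {q} hp hq = ℚₚ.nonNegative⁻¹ (p * q)
  {{ℚₚ.nonNeg*nonNeg⇒nonNeg p {{ℚ.nonNegative hp}} q {{ℚ.nonNegative hq}}}}

*-pos : ∀ {p q} → 0ℚ < p → 0ℚ < q → 0ℚ < p * q
*-pos {p} {q} hp hq = ℚₚ.positive⁻¹ (p * q)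
  {{ℚₚ.pos*pos⇒pos p {{ℚ.positive hp}} q {{ℚ.positive hq}}}}

divPos-*-cancelʳ : ∀ p q (q>0 : 0ℚ < q) → divPos p q q>0 * q ≡ p
divPos-*-cancelʳ p q q>0 = begin
  p * ℚ.1/_ q {{q≢0}} * q   ≡⟨ ℚₚ.*-assoc p _ q ⟩
  p * (ℚ.1/_ q {{q≢0}} * q) ≡⟨ cong (p *_) (ℚₚ.*-inverseˡ q {{q≢0}}) ⟩
  p * 1ℚ                    ≡⟨ ℚₚ.*-identityʳ p ⟩
  p                         ∎
  where
  open ≡-Reasoning
  q≢0 = ℚ.>-nonZero q>0

module _ {p q : ℚ} (q>0 : 0ℚ < q) where
  private
    instance
      q-pos : ℚ.Positive q
      q-pos = ℚ.positive q>0
      q-nonNeg : ℚ.NonNegative q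
      q-nonNeg = ℚ.nonNegative (ℚₚ.<⇒≤ q>0)

  ≤*⇒divPos≤ : ∀ {r} → p ≤ r * q → divPos p q q>0 ≤ r
  ≤*⇒divPos≤ h = ℚₚ.*-cancelʳ-≤-pos q (subst (_≤ _) (sym (divPos-*-cancelʳ p q q>0)) h)

  divPos≤⇒≤* : ∀ {r} → divPos p q q>0 ≤ r → p ≤ r * q
  divPos≤⇒≤* h = subst (_≤ _) (divPos-*-cancelʳ p q q>0) (ℚₚ.*-monoʳ-≤-nonNeg q h)

  ≤divPos⇒*≤ : ∀ {r} → r ≤ divPos p q q>0 → r * q ≤ p
  ≤divPos⇒*≤ h = subst (_ ≤_) (divPos-*-cancelʳ p q q>0) (ℚₚ.*-monoʳ-≤-nonNeg q h)

  <divPos⇒*< : ∀ {r} → r < divPos p q q>0 → r * q < p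
  <divPos⇒*< h = subst (_ <_) (divPos-*-cancelʳ p q q>0) (ℚₚ.*-monoˡ-<-pos q h)

infixl 7 _onlyIf_

_onlyIf_ : {A : Set} → ℚ → Dec A → ℚ
x onlyIf d = if does d then x else 0ℚ

module _ {A : Set} where

  onlyIf-accept : ∀ x (d : Dec A) → A → x onlyIf d ≡ x
  onlyIf-accept x (yes _) _ = refl
  onlyIf-accept x (no ¬a) a = ⊥-elim (¬a a)

  onlyIf-zero : ∀ (d : Dec A) → 0ℚ onlyIf d ≡ 0ℚ
  onlyIf-zero (yes _) = refl
  onlyIf-zero (no _) = refl

  onlyIf-nonNeg : ∀ {x} (d : Dec A) → 0ℚ ≤ x → 0ℚ ≤ x onlyIf d
  onlyIf-nonNeg (yes _) h = h
  onlyIf-nonNeg (no _) h = ℚₚ.≤-refl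

  onlyIf-≤ : ∀ {x} (d : Dec A) → 0ℚ ≤ x → x onlyIf d ≤ x
  onlyIf-≤ (yes _) h = ℚₚ.≤-refl
  onlyIf-≤ (no _) h = h

  onlyIf-mono : ∀ {x y} (d : Dec A) → x ≤ y → x onlyIf d ≤ y onlyIf d
  onlyIf-mono (yes _) h = h
  onlyIf-mono (no _) h = ℚₚ.≤-refl

  onlyIf-cong-iff : ∀ {B : Set} x (d : Dec A) (e : Dec B) → (A → B) → (B → A) →
                    x onlyIf d ≡ x onlyIf e
  onlyIf-cong-iff x (yes _) (yes _) _ _ = refl
  onlyIf-cong-iff x (no _)  (no _)  _ _ = refl
  onlyIf-cong-iff x (yes a) (no ¬b) f _ = ⊥-elim (¬b (f a))
  onlyIf-cong-iff x (no ¬a) (yes b) _ g = ⊥-elim (¬a (g b))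

  onlyIf-comm : ∀ {B : Set} x (d : Dec A) (e : Dec B) → x onlyIf d onlyIf e ≡ x onlyIf e onlyIf d
  onlyIf-comm x (yes _) (yes _) = refl
  onlyIf-comm x (yes _) (no _) = refl
  onlyIf-comm x (no _) (yes _) = refl
  onlyIf-comm x (no _) (no _) = refl

sumFin-cong : ∀ n {f g : Fin n → ℚ} → (∀ x → f x ≡ g x) → sumFin n f ≡ sumFin n g
sumFin-cong zero    f≡g = refl
sumFin-cong (suc n) f≡g = cong₂ _+_ (f≡g zero) (sumFin-cong n (f≡g ∘ suc))

sumFin-mono : ∀ n {f g : Fin n → ℚ} → (∀ x → f x ≤ g x) → sumFin n f ≤ sumFin n g
sumFin-mono zero    f≤g = ℚₚ.≤-refl
sumFin-mono (suc n) f≤g = ℚₚ.+-mono-≤ (f≤g zero) (sumFin-mono n (f≤g ∘ suc))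

sumFin-zero : ∀ n → sumFin n (λ _ → 0ℚ) ≡ 0ℚ
sumFin-zero zero    = refl
sumFin-zero (suc n) = trans (ℚₚ.+-identityˡ _) (sumFin-zero n)

sumFin-nonNeg : ∀ n {f : Fin n → ℚ} → (∀ x → 0ℚ ≤ f x) → 0ℚ ≤ sumFin n f
sumFin-nonNeg n {f} f≥0 = subst (_≤ sumFin n f) (sumFin-zero n) (sumFin-mono n f≥0)

sumFin-≤0 : ∀ n {f : Fin n → ℚ} → (∀ x → f x ≤ 0ℚ) → sumFin n f ≤ 0ℚ
sumFin-≤0 n {f} f≤0 = subst (sumFin n f ≤_) (sumFin-zero n) (sumFin-mono n f≤0)

sumFin-+ : ∀ n (f g : Fin n → ℚ) → sumFin n (λ x → f x + g x) ≡ sumFin n f + sumFin n g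
sumFin-+ zero    f g = sym (ℚₚ.+-identityˡ 0ℚ)
sumFin-+ (suc n) f g = begin
  (f zero + g zero) + sumFin n (λ x → f (suc x) + g (suc x))
    ≡⟨ cong (f zero + g zero +_) (sumFin-+ n (f ∘ suc) (g ∘ suc)) ⟩
  (f zero + g zero) + (sumFin n (f ∘ suc) + sumFin n (g ∘ suc))
    ≡⟨ interchange (f zero) (g zero) _ _ ⟩
  (f zero + sumFin n (f ∘ suc)) + (g zero + sumFin n (g ∘ suc)) ∎
  where
  open ≡-Reasoning
  open ℚSolver.+-*-Solver
  interchange : ∀ a b c d → (a + b) + (c + d) ≡ (a + c) + (b + d)
  interchange = solve 4 (λ a b c d → (a :+ b) :+ (c :+ d) := (a :+ c) :+ (b :+ d)) refl

sumFin-comm : ∀ n m (f : Fin n → Fin m → ℚ) →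
              sumFin n (λ x → sumFin m (f x)) ≡ sumFin m (λ y → sumFin n (λ x → f x y))
sumFin-comm zero    m f = sym (sumFin-zero m)
sumFin-comm (suc n) m f = trans (cong (sumFin m (f zero) +_) (sumFin-comm n m (f ∘ suc)))
                                (sym (sumFin-+ m (f zero) (λ y → sumFin n (λ x → f (suc x) y))))

≤-sumFin : ∀ n {f : Fin n → ℚ} → (∀ x → 0ℚ ≤ f x) → ∀ x → f x ≤ sumFin n f
≤-sumFin (suc n) f≥0 zero    = p≤p+q _ (sumFin-nonNeg n (f≥0 ∘ suc))
≤-sumFin (suc n) {f} f≥0 (suc x) = ℚₚ.≤-trans (≤-sumFin n (f≥0 ∘ suc) x)
  (subst (_≤ f zero + sumFin n (f ∘ suc)) (ℚₚ.+-identityˡ _) (ℚₚ.+-monoˡ-≤ _ (f≥0 zero)))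

sumFin-onlyIf-≟ : ∀ m (t : Fin m) (f : Fin m → ℚ) → sumFin m (λ h → f h onlyIf (t ≟ h)) ≡ f t
sumFin-onlyIf-≟ (suc m) zero    f = trans (cong (f zero +_) (sumFin-zero m)) (ℚₚ.+-identityʳ (f zero))
sumFin-onlyIf-≟ (suc m) (suc t) f = trans (ℚₚ.+-identityˡ _) (sumFin-onlyIf-≟ m t (f ∘ suc))

sumFin-fibres : ∀ n m (τ : Fin n → Fin m) (f : Fin n → ℚ) →
                sumFin n f ≡ sumFin m (λ h → sumFin n (λ j → f j onlyIf (τ j ≟ h)))
sumFin-fibres n m τ f = trans (sumFin-cong n (λ j → sym (sumFin-onlyIf-≟ m (τ j) (λ _ → f j))))
                              (sumFin-comm n m (λ j h → f j onlyIf (τ j ≟ h)))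

sumFin-onlyIf-≤-split : ∀ m (f : Fin m → ℚ) (i : Fin m) →
  sumFin m (λ h → f h onlyIf (h Fin.≤? i)) ≡ sumFin m (λ h → f h onlyIf (h Fin.<? i)) + f i
sumFin-onlyIf-≤-split m f i = begin
  sumFin m (λ h → f h onlyIf (h Fin.≤? i))
    ≡⟨ sumFin-cong m (λ h → split h (h Fin.<? i) (h Fin.≤? i) (i ≟ h)) ⟩
  sumFin m (λ h → f h onlyIf (h Fin.<? i) + f h onlyIf (i ≟ h))
    ≡⟨ sumFin-+ m _ _ ⟩
  sumFin m (λ h → f h onlyIf (h Fin.<? i)) + sumFin m (λ h → f h onlyIf (i ≟ h))
    ≡⟨ cong (sumFin m (λ h → f h onlyIf (h Fin.<? i)) +_) (sumFin-onlyIf-≟ m i f) ⟩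
  sumFin m (λ h → f h onlyIf (h Fin.<? i)) + f i ∎
  where
  open ≡-Reasoning
  split : ∀ h (h<i : Dec (h Fin.< i)) (h≤i : Dec (h Fin.≤ i)) (i≡h : Dec (i ≡ h)) →
          f h onlyIf h≤i ≡ f h onlyIf h<i + f h onlyIf i≡h
  split h (yes h<i) _          (yes refl) = ⊥-elim (Finₚ.<-irrefl refl h<i)
  split h (yes h<i) (yes _)    (no _)     = sym (ℚₚ.+-identityʳ (f h))
  split h (yes h<i) (no h≰i)   _          = ⊥-elim (h≰i (ℕₚ.<⇒≤ h<i))
  split h (no _)    (yes _)    (yes refl) = sym (ℚₚ.+-identityˡ (f h))
  split h (no h≮i)  (yes h≤i)  (no i≢h)   = ⊥-elim (h≮i (Finₚ.≤∧≢⇒< h≤i (i≢h ∘ sym)))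
  split h (no _)    (no h≰i)   (yes refl) = ⊥-elim (h≰i Finₚ.≤-refl)
  split h (no _)    (no _)     (no _)     = sym (ℚₚ.+-identityˡ 0ℚ)

≤-maxFin : ∀ m (f : Fin m → ℚ) x → f x ≤ maxFin m f
≤-maxFin (suc m) f zero    = ℚₚ.p≤p⊔q _ _
≤-maxFin (suc m) f (suc x) = ℚₚ.≤-trans (≤-maxFin m (f ∘ suc) x) (ℚₚ.p≤q⊔p (f zero) _)

prefixSum : ∀ n → (Fin n → ℚ) → Fin n → ℚ
prefixSum n a j = sumFin n (λ ℓ → a ℓ onlyIf (ℓ Fin.<? j))

≤-sumFin-prefixSum≤ : ∀ n (a : Fin n → ℚ) → (∀ j → 0ℚ ≤ a j) → ∀ X → X ≤ sumFin n a →
                      X ≤ sumFin n (λ j → a j onlyIf (prefixSum n a j ℚ.≤? X))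
≤-sumFin-prefixSum≤ zero    a a≥0 X X≤Σa = X≤Σa
≤-sumFin-prefixSum≤ (suc n) a a≥0 X X≤Σa with 0ℚ ℚ.≤? X
... | no  X≱0 = ℚₚ.≤-trans (ℚₚ.<⇒≤ (ℚₚ.≰⇒> X≱0))
                  (sumFin-nonNeg (suc n) (λ j → onlyIf-nonNeg (prefixSum (suc n) a j ℚ.≤? X) (a≥0 j)))
... | yes X≥0 = subst (X ≤_) (cong₂ _+_ (sym first) (sym rest)) (p-q≤r⇒p≤q+r
                  (≤-sumFin-prefixSum≤ n (a ∘ suc) (a≥0 ∘ suc) (X - a zero) (p≤q+r⇒p-q≤r X≤Σa)))
  where
  first : a zero onlyIf (prefixSum (suc n) a zero ℚ.≤? X) ≡ a zero
  first = onlyIf-accept (a zero) (prefixSum (suc n) a zero ℚ.≤? X)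
            (subst (_≤ X) (sym (trans (ℚₚ.+-identityˡ _) (sumFin-zero n))) X≥0)
  rest : sumFin n (λ j → a (suc j) onlyIf (prefixSum (suc n) a (suc j) ℚ.≤? X))
       ≡ sumFin n (λ j → a (suc j) onlyIf (prefixSum n (a ∘ suc) j ℚ.≤? X - a zero))
  rest = sumFin-cong n (λ j → onlyIf-cong-iff (a (suc j))
           (prefixSum (suc n) a (suc j) ℚ.≤? X) (prefixSum n (a ∘ suc) j ℚ.≤? X - a zero)
           q+p≤r⇒p≤r-q p≤r-q⇒q+p≤r)

assignedWork : ∀ {n m} → (Fin n → ℚ) → Schedule n m → Fin m → Fin n → ℚ
assignedWork p σ h ℓ = p ℓ onlyIf (σ ℓ ≟ h)

workOnBefore≡prefixSum : ∀ {n m} (p : Fin n → ℚ) (σ : Schedule n m) h j →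
                         workOnBefore p σ h j ≡ prefixSum n (assignedWork p σ h) j
workOnBefore≡prefixSum p σ h j = sumFin-cong _ (λ ℓ → onlyIf-comm (p ℓ) (ℓ Fin.<? j) (σ ℓ ≟ h))

p≤workOn : ∀ {n m} (p : Fin n → ℚ) → (∀ j → 0ℚ ≤ p j) → (σ : Schedule n m) →
           ∀ j → p j ≤ workOn p σ (σ j)
p≤workOn {n} p p≥0 σ j = subst (_≤ workOn p σ (σ j)) (onlyIf-accept (p j) (σ j ≟ σ j) refl)
  (≤-sumFin n (λ ℓ → onlyIf-nonNeg (σ ℓ ≟ σ j) (p≥0 ℓ)) j)

module _ {n m} (p : Fin n → ℚ) (s : Fin m → ℚ) (spos : ∀ h → 0ℚ < s h) where

  workOn≤makespan*speed : ∀ σ h → workOn p σ h ≤ makespan p s spos σ * s h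
  workOn≤makespan*speed σ h = divPos≤⇒≤* (spos h) (≤-maxFin m (load p s spos σ) h)

  optimal-workOn≤ : ∀ {C} (opt : IsOptimalMakespan p s spos C) h →
                    workOn p (proj₁ (proj₁ opt)) h ≤ C * s h
  optimal-workOn≤ ((σ* , makespan≡C) , _) h = subst (λ c → workOn p σ* h ≤ c * s h) makespan≡C
    (workOn≤makespan*speed σ* h)

  nearList-load≤ : ∀ {σ} → IsNearListSchedule p s spos σ → ∀ {h i' j t} → ¬ i' ≡ h → σ j ≡ h →
                   workOnBefore p σ h j ≤ t * s h →
                   load p s spos σ h ≤ t + (load p s spos σ i' + divPos (p j) (s i') (spos i'))
  nearList-load≤ nearList {h} {i'} {j} {t} i'≢h σj≡h before≤ = ℚₚ.≤-trans
    (p-q≤r⇒p≤q+r (nearList h i' j i'≢h σj≡h))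
    (ℚₚ.+-monoˡ-≤ _ (≤*⇒divPos≤ (spos h) {t} before≤))

∉H⇒underloadedPrefix : ∀ {n m} (p : Fin n → ℚ) (s : Fin m → ℚ) spos σ C k i →
  ¬ InH p s spos σ C k i → Σ (Fin m) λ i₀ → i₀ Fin.≤ i × load p s spos σ i₀ < (ℤ.+ k ℚ./ 1) * C
∉H⇒underloadedPrefix {m = m} p s spos σ C k i i∉H
  with Finₚ.¬∀⟶∃¬ m _ (λ i' → (i' Fin.≤? i) →-dec ((ℤ.+ k ℚ./ 1) * C ℚ.≤? load p s spos σ i'))
                   i∉H
... | i₀ , ¬kC≤L with i₀ Fin.≤? i
...   | yes i₀≤i = i₀ , i₀≤i , ℚₚ.≰⇒> (λ kC≤L → ¬kC≤L (λ _ → kC≤L))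
...   | no  i₀≰i = ⊥-elim (¬kC≤L (λ i₀≤i → ⊥-elim (i₀≰i i₀≤i)))

module SpeedRatioContradiction
  {m n : ℕ} (s : Fin m → ℚ) (spos : ∀ h → 0ℚ < s h)
  (s-antitone : ∀ h h' → h Fin.≤ h' → s h' ≤ s h)
  (p : Fin n → ℚ) (p≥0 : ∀ j → 0ℚ ≤ p j)
  (C : ℚ) (C>0 : 0ℚ < C) (opt : IsOptimalMakespan p s spos C)
  (σ : Schedule n m) (nearList : IsNearListSchedule p s spos σ)
  (k : ℕ) (4≤k : 4 ℕ.≤ k) (i : Fin m) (i∈Hₖ : InH p s spos σ C k i)
  (i₀ : Fin m) (i₀-low : load p s spos σ i₀ < (ℤ.+ (k ∸ 4) ℚ./ 1) * C)
  (i-slow : s i < two * s i₀)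
  where

  L : Fin m → ℚ
  L = load p s spos σ

  B : ℚ
  B = (ℤ.+ (k ∸ 4) ℚ./ 1) * C

  two≥0 : 0ℚ ≤ two
  two≥0 = ℚₚ.nonNegative⁻¹ two {{ℚₚ.normalize-nonNeg 2 1}}

  C≥0 : 0ℚ ≤ C
  C≥0 = ℚₚ.<⇒≤ C>0

  2C≥0 : 0ℚ ≤ two * C
  2C≥0 = *-nonNeg two≥0 C≥0

  B≥0 : 0ℚ ≤ B
  B≥0 = *-nonNeg (ℚₚ.nonNegative⁻¹ (ℤ.+ (k ∸ 4) ℚ./ 1) {{ℚₚ.normalize-nonNeg (k ∸ 4) 1}}) C≥0

  kC≡B+2C+2C : (ℤ.+ k ℚ./ 1) * C ≡ B + two * C + two * C
  kC≡B+2C+2C = begin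
    (ℤ.+ k ℚ./ 1) * C
      ≡⟨ cong (λ x → (ℤ.+ x ℚ./ 1) * C) (ℕₚ.m∸n+n≡m 4≤k) ⟨
    (ℤ.+ (k ∸ 4 ℕ.+ 4) ℚ./ 1) * C
      ≡⟨ cong (_* C) (+/1-homo-+ (k ∸ 4) 4) ⟩
    (ℤ.+ (k ∸ 4) ℚ./ 1 + ℤ.+ 4 ℚ./ 1) * C
      ≡⟨ distrib (ℤ.+ (k ∸ 4) ℚ./ 1) C ⟩
    B + two * C + two * C ∎
    where
    open ≡-Reasoning
    open ℚSolver.+-*-Solver
    distrib : ∀ x c → (x + ℤ.+ 4 ℚ./ 1) * c ≡ x * c + two * c + two * c
    distrib = solve 2 (λ x c → (x :+ con (ℤ.+ 4 ℚ./ 1)) :* c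
                             := x :* c :+ con two :* c :+ con two :* c) refl

  ≤i⇒B+2C+≤i⇒2C≤L : ∀ {h} → h Fin.≤ i → B + two * C + two * C ≤ L h
  ≤i⇒B+2C+≤i⇒2C≤L h≤i = subst (_≤ L _) kC≡B+2C+2C (i∈Hₖ _ h≤i)

  ≤i⇒2C≤L : ∀ {h} → h Fin.≤ i → two * C ≤ L h
  ≤i⇒2C≤L h≤i = ℚₚ.≤-trans (subst (_≤ B + two * C + two * C) (ℚₚ.+-identityˡ (two * C))
                           (ℚₚ.+-monoˡ-≤ (two * C) (ℚₚ.+-mono-≤ B≥0 2C≥0)))
                        (≤i⇒B+2C+≤i⇒2C≤L h≤i)

  ≤i⇒≢i₀ : ∀ {h} → h Fin.≤ i → ¬ i₀ ≡ h
  ≤i⇒≢i₀ h≤i refl = ℚₚ.<-irrefl refl (ℚₚ.<-≤-trans i₀-low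
    (ℚₚ.≤-trans (ℚₚ.≤-trans (p≤p+q B 2C≥0) (p≤p+q _ 2C≥0)) (≤i⇒B+2C+≤i⇒2C≤L h≤i)))

  early-job-large : ∀ {h j} → h Fin.≤ i → σ j ≡ h → workOnBefore p σ h j ≤ two * C * s h →
                    C * s i < p j
  early-job-large {h} {j} h≤i σj≡h early = begin-strict
    C * s i          <⟨ ℚₚ.*-monoʳ-<-pos C {{ℚ.positive C>0}} i-slow ⟩
    C * (two * s i₀) ≡⟨ *-swap C two (s i₀) ⟩
    two * C * s i₀   <⟨ <divPos⇒*< (spos i₀) 2C<p/s ⟩
    p j              ∎
    where
    open ℚₚ.≤-Reasoning
    *-swap : ∀ x y z → x * (y * z) ≡ y * x * z
    *-swap = solve 3 (λ x y z → x :* (y :* z) := y :* x :* z) refl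
      where open ℚSolver.+-*-Solver
    p/s = divPos (p j) (s i₀) (spos i₀)
    2C<p/s : two * C < p/s
    2C<p/s = +-cancelˡ-< B (+-cancelˡ-< (two * C) (begin-strict
      two * C + (B + two * C)  ≡⟨ ℚₚ.+-comm (two * C) _ ⟩
      B + two * C + two * C    ≤⟨ ≤i⇒B+2C+≤i⇒2C≤L h≤i ⟩
      L h                      ≤⟨ nearList-load≤ p s spos nearList {t = two * C} (≤i⇒≢i₀ h≤i) σj≡h early ⟩
      two * C + (L i₀ + p/s)   <⟨ ℚₚ.+-monoʳ-< (two * C) (ℚₚ.+-monoˡ-< p/s i₀-low) ⟩
      two * C + (B + p/s)      ∎))

  T : Fin m → ℚ
  T h = two * C * s h

  earlyWork : Fin n → ℚ
  earlyWork j = p j onlyIf (workOnBefore p σ (σ j) j ℚ.≤? T (σ j)) onlyIf (σ j Fin.≤? i)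

  earlyWork≥0 : ∀ j → 0ℚ ≤ earlyWork j
  earlyWork≥0 j = onlyIf-nonNeg (σ j Fin.≤? i)
    (onlyIf-nonNeg (workOnBefore p σ (σ j) j ℚ.≤? T (σ j)) (p≥0 j))

  earlyWork≤p : ∀ j → earlyWork j ≤ p j
  earlyWork≤p j = ℚₚ.≤-trans
    (onlyIf-≤ (σ j Fin.≤? i) (onlyIf-nonNeg (workOnBefore p σ (σ j) j ℚ.≤? T (σ j)) (p≥0 j)))
    (onlyIf-≤ (workOnBefore p σ (σ j) j ℚ.≤? T (σ j)) (p≥0 j))

  earlyWork-fibre : ∀ {h} → h Fin.≤ i → ∀ j → earlyWork j onlyIf (σ j ≟ h)
    ≡ assignedWork p σ h j onlyIf (prefixSum n (assignedWork p σ h) j ℚ.≤? T h)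
  earlyWork-fibre {h} h≤i j with σ j ≟ h
  ... | no  _    = sym (onlyIf-zero (prefixSum n (assignedWork p σ h) j ℚ.≤? T h))
  ... | yes refl = begin
    earlyWork j
      ≡⟨ onlyIf-accept _ (σ j Fin.≤? i) h≤i ⟩
    p j onlyIf (workOnBefore p σ (σ j) j ℚ.≤? T (σ j))
      ≡⟨ cong (λ w → p j onlyIf (w ℚ.≤? T (σ j))) (workOnBefore≡prefixSum p σ (σ j) j) ⟩
    p j onlyIf (prefixSum n (assignedWork p σ (σ j)) j ℚ.≤? T (σ j)) ∎
    where open ≡-Reasoning

  earlyWork-on-σ≥ : ∀ h (h≤?i : Dec (h Fin.≤ i)) →
                    T h onlyIf h≤?i ≤ sumFin n (λ j → earlyWork j onlyIf (σ j ≟ h))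
  earlyWork-on-σ≥ h (no  _)   = sumFin-nonNeg n (λ j → onlyIf-nonNeg (σ j ≟ h) (earlyWork≥0 j))
  earlyWork-on-σ≥ h (yes h≤i) = subst (T h ≤_) (sym (sumFin-cong n (earlyWork-fibre h≤i)))
    (≤-sumFin-prefixSum≤ n (assignedWork p σ h) (λ ℓ → onlyIf-nonNeg (σ ℓ ≟ h) (p≥0 ℓ)) (T h)
      (≤divPos⇒*≤ (spos h) (≤i⇒2C≤L h≤i)))

  σ* : Schedule n m
  σ* = proj₁ (proj₁ opt)

  earlyWork≤0-beyond-i : ∀ j → i Fin.≤ σ* j → earlyWork j ≤ 0ℚ
  earlyWork≤0-beyond-i j i≤σ*j = early≤0 (σ j Fin.≤? i) (workOnBefore p σ (σ j) j ℚ.≤? T (σ j))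
    where
    large-fits : C * s i < p j → ⊥
    large-fits large = ℚₚ.<-irrefl refl (ℚₚ.<-≤-trans large
      (ℚₚ.≤-trans (ℚₚ.≤-trans (p≤workOn p p≥0 σ* j) (optimal-workOn≤ p s spos opt (σ* j)))
                  (ℚₚ.*-monoˡ-≤-nonNeg C {{ℚ.nonNegative C≥0}} (s-antitone i (σ* j) i≤σ*j))))
    early≤0 : (σj≤?i : Dec (σ j Fin.≤ i)) (early? : Dec (workOnBefore p σ (σ j) j ≤ T (σ j))) →
              p j onlyIf early? onlyIf σj≤?i ≤ 0ℚ
    early≤0 (no  _)    _           = ℚₚ.≤-refl
    early≤0 (yes _)    (no  _)     = ℚₚ.≤-refl
    early≤0 (yes σj≤i) (yes early) = ⊥-elim (large-fits (early-job-large σj≤i refl early))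

  earlyWork-on-σ*≤ : ∀ h (h<?i : Dec (h Fin.< i)) →
                     sumFin n (λ j → earlyWork j onlyIf (σ* j ≟ h)) ≤ C * s h onlyIf h<?i
  earlyWork-on-σ*≤ h (yes _)   = ℚₚ.≤-trans
    (sumFin-mono n (λ j → onlyIf-mono (σ* j ≟ h) (earlyWork≤p j)))
    (optimal-workOn≤ p s spos opt h)
  earlyWork-on-σ*≤ h (no  h≮i) = sumFin-≤0 n (λ j → fibre≤0 j (σ* j ≟ h))
    where
    fibre≤0 : ∀ j (d : Dec (σ* j ≡ h)) → earlyWork j onlyIf d ≤ 0ℚ
    fibre≤0 j (yes refl) = earlyWork≤0-beyond-i j (ℕₚ.≮⇒≥ h≮i)
    fibre≤0 j (no  _)    = ℚₚ.≤-refl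

  absurd : ⊥
  absurd = ℚₚ.<-irrefl refl (ℚₚ.<-≤-trans (*-pos C>0 (spos i)) (+-cancelˡ-≤ S (begin
    S + C * s i
      ≡⟨ sumFin-onlyIf-≤-split m (λ h → C * s h) i ⟨
    sumFin m (λ h → C * s h onlyIf (h Fin.≤? i))
      ≤⟨ sumFin-mono m (λ h → onlyIf-mono (h Fin.≤? i) C*s≤T) ⟩
    sumFin m (λ h → T h onlyIf (h Fin.≤? i))
      ≤⟨ sumFin-mono m (λ h → earlyWork-on-σ≥ h (h Fin.≤? i)) ⟩
    sumFin m (λ h → sumFin n (λ j → earlyWork j onlyIf (σ j ≟ h)))
      ≡⟨ sumFin-fibres n m σ earlyWork ⟨
    sumFin n earlyWork
      ≡⟨ sumFin-fibres n m σ* earlyWork ⟩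
    sumFin m (λ h → sumFin n (λ j → earlyWork j onlyIf (σ* j ≟ h)))
      ≤⟨ sumFin-mono m (λ h → earlyWork-on-σ*≤ h (h Fin.<? i)) ⟩
    S
      ≡⟨ ℚₚ.+-identityʳ S ⟨
    S + 0ℚ ∎)))
    where
    open ℚₚ.≤-Reasoning
    S : ℚ
    S = sumFin m (λ h → C * s h onlyIf (h Fin.<? i))
    C*s≤T : ∀ {h} → C * s h ≤ T h
    C*s≤T {h} = subst (C * s h ≤_) (sym (ℚₚ.*-assoc two C (s h)))
                  (p≤two*p (*-nonNeg C≥0 (ℚₚ.<⇒≤ (spos h))))

lemma11 : (m n : ℕ) (s : Fin m → ℚ) (spos : (i : Fin m) → 0ℚ < s i)
          → ((i i' : Fin m) → i Fin.≤ i' → s i' ≤ s i)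
          → (p : Fin n → ℚ) → ((j : Fin n) → (0ℚ ≤ p j) × (p j ≤ 1ℚ))
          → (Cstar : ℚ) (Cpos : 0ℚ < Cstar) → IsOptimalMakespan p s spos Cstar
          → (σ : Schedule n m) → IsNearListSchedule p s spos σ
          → (k : ℕ) → 5 ℕ.≤ k → ℤ.+ k ℤ.≤ cValue p s spos σ Cstar Cpos
          → Σ (Fin m) (InH p s spos σ Cstar k)
          → (i i'' : Fin m) → InH p s spos σ Cstar k i
          → ¬ InH p s spos σ Cstar (k ∸ 4) i''
          → (ℤ.+ 2 ℚ./ 1) * s i'' ≤ s i
lemma11 m n s spos s-antitone p p-bounds C C>0 opt σ nearList k 5≤k _ _ i i'' i∈Hₖ i''∉Hₖ₋₄
  with two * s i'' ℚ.≤? s i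
... | yes 2s''≤s = 2s''≤s
... | no  2s''≰s with ∉H⇒underloadedPrefix p s spos σ C (k ∸ 4) i'' i''∉Hₖ₋₄
...   | i₀ , i₀≤i'' , i₀-low = ⊥-elim (SpeedRatioContradiction.absurd
          s spos s-antitone p (proj₁ ∘ p-bounds) C C>0 opt σ nearList
          k (ℕₚ.<⇒≤ 5≤k) i i∈Hₖ i₀ i₀-low
          (ℚₚ.<-≤-trans (ℚₚ.≰⇒> 2s''≰s)
            (ℚₚ.*-monoˡ-≤-nonNeg two {{ℚₚ.normalize-nonNeg 2 1}} (s-antitone i₀ i'' i₀≤i''))))
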